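{- Let $G=(V,E)$ be an embedded graph and $V_c\subset V$ a cutset of $G$ such that for at least two components $C_1,C_2$ of $G-V_c$ the sets $F_{C_1}$ and $F_{C_2}$ are nonempty. Then $F_{b,C_1}$ is a cutset (its removal disconnects the graph) in the dual graph $G^*$.
   Context: An embedded graph is a connected graph with a combinatorial (rotation system) embedding in an orientable surface; faces are cyclic sequences $(v_0,v_1),\dots,(v_{k-1},v_0)$ of pairwise different directed edges determined by the rotation system. A vertex $v$ is in a face $f$ if it occurs in a directed edge of $f$. The dual $G^*$ has the faces of $G$ as vertices, two faces being adjacent when they share an edge of $G$. A cutset is a set of vertices whose removal disconnects the graph. For a cutset $V_c$: the set $F_b$ of boundary faces consists of all faces $(v_0,v_1),\dots,(v_{k-1},v_0)$ for which there are indices $0\le i<j\le k-1$ with $v_i\in V_c$ and $v_j\in V_c$ ($v_i=v_j$ allowed). For a component $C$ of $G-V_c$, $F_{b,C}$ is the set of faces in $F_b$ containing at least one vertex of $C$, and $F_C$ is the set of faces of $G$ not in $F_b$ all of whose boundary vertices lie in $C\cup V_c$. -}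

module Defs where

open import Data.Nat using (ℕ; zero; suc)
open import Data.Fin using (Fin)
open import Data.Fin.Subset using (Subset; _∈_; _∉_; ⊥)
open import Data.Product using (Σ; ∃; ∃-syntax; _×_; _,_)
open import Data.Sum using (_⊎_)
open import Relation.Nullary using (¬_)
open import Relation.Binary.PropositionalEquality using (_≡_; _≢_)
open import Relation.Binary.Construct.Closure.ReflexiveTransitive using (Star)

iter : ∀ {A : Set} → (A → A) → ℕ → A → A
iter f zero    x = x
iter f (suc k) x = f (iter f k x)

-- An embedded graph, given combinatorially by a rotation system.  Each undirected
-- edge {u,v} gives the two darts (u,v) and (v,u) = rev of each other.
-- rot d is the successor of dart d in the cyclic order (rotation) of darts
-- leaving the vertex tail d.
record EmbeddedGraph : Set where
  field
    nV nD   : ℕ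
    tail    : Fin nD → Fin nV
    rev     : Fin nD → Fin nD
    rev-inv : ∀ d → rev (rev d) ≡ d
  head : Fin nD → Fin nV
  head d = tail (rev d)
  field
    no-loop     : ∀ d → tail d ≢ head d
    no-parallel : ∀ d e → tail d ≡ tail e → head d ≡ head e → d ≡ e
    rot      : Fin nD → Fin nD
    rot⁻¹    : Fin nD → Fin nD
    rot-inv₁ : ∀ d → rot (rot⁻¹ d) ≡ d
    rot-inv₂ : ∀ d → rot⁻¹ (rot d) ≡ d
    rot-tail : ∀ d → tail (rot d) ≡ tail d
    rot-cyclic : ∀ d e → tail d ≡ tail e → ∃[ k ] iter rot k d ≡ e

  AdjAvoid : Subset nV → Fin nV → Fin nV → Set
  AdjAvoid X u v = u ∉ X × v ∉ X × ∃[ d ] (tail d ≡ u × head d ≡ v)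

  ConnAvoid : Subset nV → Fin nV → Fin nV → Set
  ConnAvoid X = Star (AdjAvoid X)

  -- face successor: the dart following (u,v) in its face is (v,w), where
  -- w follows u in the rotation at v
  next : Fin nD → Fin nD
  next d = rot (rev d)

  -- darts d and e lie on the same face (face = orbit of next)
  SameFace : Fin nD → Fin nD → Set
  SameFace d e = ∃[ k ] iter next k d ≡ e

  VertexInFace : Fin nV → Fin nD → Set
  VertexInFace v f = ∃[ d ] (SameFace f d × (tail d ≡ v ⊎ head d ≡ v))

  -- faces of G-duals: a face is represented by any of its darts.
  -- Dual adjacency: the faces of d and e share an edge of G.
  DualAdj : Fin nD → Fin nD → Set
  DualAdj d e = ∃[ x ] (SameFace d x × SameFace e (rev x))

  -- connectivity in G* - S, for a set S of faces given as a predicate on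
  -- representing darts; steps either stay at the same dual vertex (same face)
  -- or move along a dual edge
  DualStep : (Fin nD → Set) → Fin nD → Fin nD → Set
  DualStep S d e = ¬ S d × ¬ S e × (SameFace d e ⊎ DualAdj d e)

  DualConnAvoid : (Fin nD → Set) → Fin nD → Fin nD → Set
  DualConnAvoid S = Star (DualStep S)

open EmbeddedGraph public

Connected : EmbeddedGraph → Set
Connected G = ∀ u v → ConnAvoid G ⊥ u v

IsCutset : (G : EmbeddedGraph) → Subset (nV G) → Set
IsCutset G Vc = ∃[ u ] ∃[ v ] (u ∉ Vc × v ∉ Vc × ¬ ConnAvoid G Vc u v)

InComp : (G : EmbeddedGraph) → Subset (nV G) → Fin (nV G) → Fin (nV G) → Set
InComp G Vc c v = v ∉ Vc × ConnAvoid G Vc c v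

-- boundary face F_b: two different positions i < j of the face cycle whose
-- vertices v_i, v_j lie in Vc (v_i = v_j allowed).  Position i corresponds to
-- the dart (v_i, v_{i+1}); darts of a face are pairwise different, so
-- different positions = different darts.
IsBoundaryFace : (G : EmbeddedGraph) → Subset (nV G) → Fin (nD G) → Set
IsBoundaryFace G Vc f =
  ∃[ d ] ∃[ e ] (SameFace G f d × SameFace G f e × d ≢ e
                 × tail G d ∈ Vc × tail G e ∈ Vc)

InFbC : (G : EmbeddedGraph) → Subset (nV G) → Fin (nV G) → Fin (nD G) → Set
InFbC G Vc c f =
  IsBoundaryFace G Vc f × ∃[ v ] (InComp G Vc c v × VertexInFace G v f)

InFC : (G : EmbeddedGraph) → Subset (nV G) → Fin (nV G) → Fin (nD G) → Set
InFC G Vc c f =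
  ¬ IsBoundaryFace G Vc f
  × (∀ v → VertexInFace G v f → InComp G Vc c v ⊎ v ∈ Vc)

IsDualCutset : (G : EmbeddedGraph) → (Fin (nD G) → Set) → Set
IsDualCutset G S =
  ∃[ f ] ∃[ g ] (¬ S f × ¬ S g × ¬ DualConnAvoid G S f g)

-- Call a face touching if it contains a vertex of the component C₁.  Walking around a face that is not
-- a boundary face meets Vc at most once, so a touching non-boundary face has all its vertices in C₁ ∪ Vc;
-- each of its edges has an endpoint outside Vc, hence in C₁, and that endpoint also lies on the face
-- across the edge.  So in G* − F_{b,C₁} touching faces are closed under adjacency: the faces of F_{C₁}
-- touch C₁, those of F_{C₂} do not, and they are separated.
module Submission where

open import Defs
open import Data.Fin using (Fin)
open import Data.Fin.Subset using (Subset; _∉_)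
open import Data.Product using (∃-syntax)
open import Relation.Nullary using (¬_)

open import Data.Nat using (ℕ; zero; suc; _+_; _*_)
open import Data.Nat.Properties using (+-comm; +-suc; *-suc; m≤n⇒∃[o]m+o≡n; n<1+n)
open import Data.Fin using (toℕ; _≟_)
open import Data.Fin.Properties using (pigeonhole)
open import Data.Fin.Subset using (_∈_)
open import Data.Fin.Subset.Properties using (_∈?_)
open import Data.Product using (_×_; _,_; proj₁)
open import Data.Sum using (_⊎_; inj₁; inj₂)
open import Data.Empty using (⊥-elim)
open import Function using (_∘_; id)
open import Function.Definitions using (Injective)
open import Relation.Nullary using (yes; no)
open import Relation.Binary.PropositionalEquality
open import Relation.Binary.Construct.Closure.ReflexiveTransitive
  using (ε; _◅_; _◅◅_; reverse; fold)

iter-+ : ∀ {A : Set} (f : A → A) m n x → iter f (m + n) x ≡ iter f m (iter f n x)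
iter-+ f zero    n x = refl
iter-+ f (suc m) n x = cong f (iter-+ f m n x)

iter-injective : ∀ {A : Set} {f : A → A} → Injective _≡_ _≡_ f →
                 ∀ n {x y} → iter f n x ≡ iter f n y → x ≡ y
iter-injective f-inj zero    eq = eq
iter-injective f-inj (suc n) eq = iter-injective f-inj n (f-inj eq)

iter-*-periodic : ∀ {A : Set} (f : A → A) {p x} → iter f p x ≡ x → ∀ a → iter f (a * p) x ≡ x
iter-*-periodic f             fᵖx≡x zero    = refl
iter-*-periodic f {p} {x} fᵖx≡x (suc a) = begin
  iter f (p + a * p) x          ≡⟨ iter-+ f p (a * p) x ⟩
  iter f p (iter f (a * p) x)   ≡⟨ cong (iter f p) (iter-*-periodic f fᵖx≡x a) ⟩
  iter f p x                    ≡⟨ fᵖx≡x ⟩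
  x                             ∎
  where open ≡-Reasoning

module _ {n : ℕ} {f : Fin n → Fin n} (f-inj : Injective _≡_ _≡_ f) where

  -- Among the n + 1 points x, f x, …, fⁿ x two coincide; injectivity cancels the common prefix.
  iter-periodic : ∀ x → ∃[ p ] iter f (suc p) x ≡ x
  iter-periodic x with pigeonhole (n<1+n n) (λ i → iter f (toℕ i) x)
  ... | i , j , i<j , fⁱx≡fʲx with m≤n⇒∃[o]m+o≡n i<j
  ... | p , i+1+p≡j = p , iter-injective f-inj (toℕ i) (begin
    iter f (toℕ i) (iter f (suc p) x)   ≡⟨ iter-+ f (toℕ i) (suc p) x ⟨
    iter f (toℕ i + suc p) x            ≡⟨ cong (λ k → iter f k x) (trans (+-suc (toℕ i) p) i+1+p≡j) ⟩
    iter f (toℕ j) x                    ≡⟨ fⁱx≡fʲx ⟨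
    iter f (toℕ i) x                    ∎)
    where open ≡-Reasoning

  iter-return : ∀ k {x y} → iter f k x ≡ y → ∃[ m ] iter f m y ≡ x
  iter-return k {x} refl with iter-periodic x
  ... | p , fᵖ⁺¹x≡x = k * p , (begin
    iter f (k * p) (iter f k x)   ≡⟨ iter-+ f (k * p) k x ⟨
    iter f (k * p + k) x          ≡⟨ cong (λ m → iter f m x) (trans (+-comm (k * p) k) (sym (*-suc k p))) ⟩
    iter f (k * suc p) x          ≡⟨ iter-*-periodic f fᵖ⁺¹x≡x k ⟩
    x                             ∎)
    where open ≡-Reasoning

module _ (G : EmbeddedGraph) where

  next-injective : Injective _≡_ _≡_ (next G)
  next-injective {d} {e} eq = begin
    d                               ≡⟨ rev-inv G d ⟨
    rev G (rev G d)                 ≡⟨ cong (rev G) (rot-inv₂ G (rev G d)) ⟨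
    rev G (rot⁻¹ G (next G d))      ≡⟨ cong (rev G ∘ rot⁻¹ G) eq ⟩
    rev G (rot⁻¹ G (next G e))      ≡⟨ cong (rev G) (rot-inv₂ G (rev G e)) ⟩
    rev G (rev G e)                 ≡⟨ rev-inv G e ⟩
    e                               ∎
    where open ≡-Reasoning

  tail-next : ∀ d → tail G (next G d) ≡ head G d
  tail-next d = rot-tail G (rev G d)

  dart≢next : ∀ d → d ≢ next G d
  dart≢next d eq = no-loop G d (trans (cong (tail G) eq) (tail-next d))

  sameFace-refl : ∀ {d} → SameFace G d d
  sameFace-refl = 0 , refl

  sameFace-next : ∀ {d} → SameFace G d (next G d)
  sameFace-next = 1 , refl

  sameFace-trans : ∀ {d e g} → SameFace G d e → SameFace G e g → SameFace G d g
  sameFace-trans {d} (i , p) (j , q) = j + i , trans (iter-+ (next G) j i d) (trans (cong (iter (next G) j) p) q)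

  sameFace-sym : ∀ {d e} → SameFace G d e → SameFace G e d
  sameFace-sym (k , p) = iter-return next-injective k p

  vertexInFace-transport : ∀ {v d e} → SameFace G d e → VertexInFace G v d → VertexInFace G v e
  vertexInFace-transport d~e (x , d~x , ends) = x , sameFace-trans (sameFace-sym d~e) d~x , ends

  vertexInFace⇒tail : ∀ {v f} → VertexInFace G v f → ∃[ y ] (SameFace G f y × tail G y ≡ v)
  vertexInFace⇒tail (y , f~y , inj₁ tail≡v) = y , f~y , tail≡v
  vertexInFace⇒tail (y , f~y , inj₂ head≡v) = next G y , sameFace-trans f~y sameFace-next , trans (tail-next y) head≡v

  module _ (Vc : Subset (nV G)) where

    connAvoid-sym : ∀ {u v} → ConnAvoid G Vc u v → ConnAvoid G Vc v u
    connAvoid-sym = reverse λ (u∉ , v∉ , d , tail≡u , head≡v) →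
      v∉ , u∉ , rev G d , head≡v , trans (cong (tail G) (rev-inv G d)) tail≡u

    -- Following the face from y, the tails stay in one component of G - Vc until the face re-enters Vc.
    faceWalk : ∀ y n → tail G y ∉ Vc →
      (tail G (iter (next G) n y) ∉ Vc × ConnAvoid G Vc (tail G y) (tail G (iter (next G) n y)))
      ⊎ ∃[ a ] (SameFace G y a × ConnAvoid G Vc (tail G y) (tail G a) × tail G (next G a) ∈ Vc)
    faceWalk y zero y∉ = inj₁ (y∉ , ε)
    faceWalk y (suc n) y∉ with faceWalk y n y∉
    ... | inj₂ exit = inj₂ exit
    ... | inj₁ (a∉ , y⇝a) with tail G (next G a) ∈? Vc
      where a = iter (next G) n y
    ...   | yes na∈ = inj₂ (_ , (n , refl) , y⇝a , na∈)
    ...   | no  na∉ = inj₁ (na∉ , y⇝a ◅◅ (a∉ , na∉ , _ , refl , sym (tail-next _)) ◅ ε)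

    -- Walking from each vertex towards the other, both walks must leave through the same dart into Vc,
    -- since two distinct darts with tail in Vc would make the face a boundary face.
    nonBoundary-face-connected : ∀ {f v w} → ¬ IsBoundaryFace G Vc f →
      VertexInFace G v f → VertexInFace G w f → v ∉ Vc → w ∉ Vc → ConnAvoid G Vc v w
    nonBoundary-face-connected nb v∈f w∈f v∉ w∉ with vertexInFace⇒tail v∈f | vertexInFace⇒tail w∈f
    ... | y , f~y , refl | z , f~z , refl
      with sameFace-trans (sameFace-sym f~y) f~z | sameFace-trans (sameFace-sym f~z) f~y
    ... | k , y→z | m , z→y with faceWalk y k v∉ | faceWalk z m w∉
    ... | inj₁ (_ , y⇝) | _ = subst (ConnAvoid G Vc _ ∘ tail G) y→z y⇝
    ... | inj₂ _ | inj₁ (_ , z⇝) = connAvoid-sym (subst (ConnAvoid G Vc _ ∘ tail G) z→y z⇝)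
    ... | inj₂ (a , y~a , y⇝a , na∈) | inj₂ (b , z~b , z⇝b , nb∈) with next G a ≟ next G b
    ...   | no na≢nb = ⊥-elim (nb (next G a , next G b ,
              sameFace-trans f~y (sameFace-trans y~a sameFace-next) ,
              sameFace-trans f~z (sameFace-trans z~b sameFace-next) , na≢nb , na∈ , nb∈))
    ...   | yes na≡nb = y⇝a ◅◅ connAvoid-sym (subst (ConnAvoid G Vc _ ∘ tail G) (sym (next-injective na≡nb)) z⇝b)

    nonBoundary-endpoint∉ : ∀ {f x} → ¬ IsBoundaryFace G Vc f → SameFace G f x → tail G x ∉ Vc ⊎ head G x ∉ Vc
    nonBoundary-endpoint∉ {f} {x} nb f~x with tail G x ∈? Vc | head G x ∈? Vc
    ... | no tail∉ | _       = inj₁ tail∉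
    ... | yes _    | no head∉ = inj₂ head∉
    ... | yes tail∈ | yes head∈ = ⊥-elim (nb (x , next G x , f~x , sameFace-trans f~x sameFace-next ,
                                              dart≢next x , tail∈ , subst (_∈ Vc) (sym (tail-next x)) head∈))

    module _ (c : Fin (nV G)) where

      TouchesComponent : Fin (nD G) → Set
      TouchesComponent f = ∃[ v ] (InComp G Vc c v × VertexInFace G v f)

      nonBoundary-within-component : ∀ {f v} → ¬ IsBoundaryFace G Vc f → TouchesComponent f →
        VertexInFace G v f → InComp G Vc c v ⊎ v ∈ Vc
      nonBoundary-within-component {v = v} nb (u , (u∉ , c⇝u) , u∈f) v∈f with v ∈? Vc
      ... | yes v∈ = inj₂ v∈
      ... | no  v∉ = inj₁ (v∉ , c⇝u ◅◅ nonBoundary-face-connected nb u∈f v∈f u∉ v∉)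

      endpoint-in-component : ∀ {f x} → ¬ IsBoundaryFace G Vc f → TouchesComponent f → SameFace G f x →
        InComp G Vc c (tail G x) ⊎ InComp G Vc c (head G x)
      endpoint-in-component nb touch f~x with nonBoundary-endpoint∉ nb f~x
      ... | inj₁ tail∉ with nonBoundary-within-component nb touch (_ , f~x , inj₁ refl)
      ...   | inj₁ inC  = inj₁ inC
      ...   | inj₂ tail∈ = ⊥-elim (tail∉ tail∈)
      endpoint-in-component nb touch f~x | inj₂ head∉ with nonBoundary-within-component nb touch (_ , f~x , inj₂ refl)
      ...   | inj₁ inC  = inj₂ inC
      ...   | inj₂ head∈ = ⊥-elim (head∉ head∈)

      dualStep-touches : ∀ {d e} → DualStep G (InFbC G Vc c) d e → TouchesComponent d → TouchesComponent e
      dualStep-touches (_ , _ , inj₁ d~e) (v , inC , v∈d) = v , inC , vertexInFace-transport d~e v∈d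
      dualStep-touches (d∉S , _ , inj₂ (x , d~x , e~rx)) touch
        with endpoint-in-component (λ bd → d∉S (bd , touch)) touch d~x
      ... | inj₁ inC = _ , inC , (rev G x , e~rx , inj₂ (cong (tail G) (rev-inv G x)))
      ... | inj₂ inC = _ , inC , (rev G x , e~rx , inj₁ refl)

      dualConn-touches : ∀ {d e} → DualConnAvoid G (InFbC G Vc c) d e → TouchesComponent d → TouchesComponent e
      dualConn-touches = fold (λ d e → TouchesComponent d → TouchesComponent e)
                              (λ step walk → walk ∘ dualStep-touches step) id

      nonBoundary-vertex∉ : ∀ {f} → ¬ IsBoundaryFace G Vc f → ∃[ v ] (v ∉ Vc × VertexInFace G v f)
      nonBoundary-vertex∉ {f} nb with nonBoundary-endpoint∉ nb sameFace-refl
      ... | inj₁ tail∉ = _ , tail∉ , (f , sameFace-refl , inj₁ refl)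
      ... | inj₂ head∉ = _ , head∉ , (f , sameFace-refl , inj₂ refl)

      inFC-touches : ∀ {f} → InFC G Vc c f → TouchesComponent f
      inFC-touches (nb , within) with nonBoundary-vertex∉ nb
      ... | v , v∉ , v∈f with within v v∈f
      ...   | inj₁ inC = v , inC , v∈f
      ...   | inj₂ v∈  = ⊥-elim (v∉ v∈)

    inFC-untouched : ∀ {c₁ c₂ f} → ¬ ConnAvoid G Vc c₁ c₂ → InFC G Vc c₂ f → ¬ TouchesComponent c₁ f
    inFC-untouched c₁≁c₂ (_ , within) (v , (v∉ , c₁⇝v) , v∈f) with within v v∈f
    ... | inj₁ (_ , c₂⇝v) = c₁≁c₂ (c₁⇝v ◅◅ connAvoid-sym c₂⇝v)
    ... | inj₂ v∈         = v∉ v∈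

lemma2 : (G : EmbeddedGraph) → Connected G → (Vc : Subset (nV G)) → IsCutset G Vc
    → (c₁ c₂ : Fin (nV G)) → c₁ ∉ Vc → c₂ ∉ Vc → ¬ ConnAvoid G Vc c₁ c₂
    → ∃[ f ] InFC G Vc c₁ f → ∃[ f ] InFC G Vc c₂ f
    → IsDualCutset G (InFbC G Vc c₁)
lemma2 G _ Vc _ c₁ c₂ _ _ c₁≁c₂ (f₁ , f₁∈F₁) (f₂ , f₂∈F₂) =
  f₁ , f₂ , proj₁ f₁∈F₁ ∘ proj₁ , proj₁ f₂∈F₂ ∘ proj₁ ,
  λ f₁⇝f₂ → inFC-untouched G Vc c₁≁c₂ f₂∈F₂ (dualConn-touches G Vc c₁ f₁⇝f₂ (inFC-touches G Vc c₁ f₁∈F₁))
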